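{- Let $\alpha,\beta,\gamma,x\in\mathbb{N}_0$ with $(\alpha,\beta,\gamma,x)\neq(0,0,0,0)$ and let $\lambda\in\mathbb{N}_0$. Then for every integer $n\ge0$, $$A^{\lambda,x}_n(\alpha,\beta,\gamma)=\sum_{k=0}^{n}\binom{k+\lambda-1}{k}\sum_{i=0}^{n}\binom{n}{i}x^k(-1)^{k+i}\beta^k k!\,S(i,k,\alpha,-\beta,0)\,(\gamma|-\alpha)_{n-i}.$$
   Context: For a number $\alpha$ and integer $n\ge0$, $(t|\alpha)_n=t(t-\alpha)\cdots(t-(n-1)\alpha)$, $(t|\alpha)_0=1$ (so $(\gamma|-\alpha)_m=\gamma(\gamma+\alpha)\cdots(\gamma+(m-1)\alpha)$). For numbers $\alpha,\beta,\gamma$ the generalised Stirling numbers $S(n,k,\alpha,\beta,\gamma)$, $0\le k\le n$, are defined by the polynomial identity $(t|\alpha)_n=\sum_{k=0}^{n}S(n,k,\alpha,\beta,\gamma)(t-\gamma|\beta)_k$, and $S(i,k,\alpha,\beta,\gamma)=0$ for $k>i$. For a number $\lambda$ and integer $k\ge0$, $\binom{k+\lambda-1}{k}=\lambda(\lambda+1)\cdots(\lambda+k-1)/k!$ (equal to $1$ for $k=0$). Define $$A^{\lambda,x}_n(\alpha,\beta,\gamma)=\sum_{k=0}^{n}\binom{k+\lambda-1}{k}(-1)^{n+k}\beta^k k!\,S(n,k,\alpha,-\beta,-\gamma)\,x^k.$$ -}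

module Defs where

open import Data.Nat as ℕ using (ℕ; zero; suc; _!)
open import Data.Nat.Properties using (_!≢0)
open import Data.Integer using (ℤ; +_; _+_; _-_; _*_; -_; _^_)

sumTo : ℕ → (ℕ → ℤ) → ℤ
sumTo zero    f = f 0
sumTo (suc n) f = sumTo n f + f (suc n)

fall : ℤ → ℤ → ℕ → ℤ
fall t α zero    = + 1
fall t α (suc n) = fall t α n * (t - (+ n) * α)

rising : ℕ → ℕ → ℕ
rising l zero    = 1
rising l (suc k) = rising l k ℕ.* (l ℕ.+ k)

-- binom(k+λ-1, k) = λ(λ+1)...(λ+k-1)/k!   (exact division; equals 1 for k = 0)
binomL : ℕ → ℕ → ℕ
binomL l k = ℕ._/_ (rising l k) (k !) {{k !≢0}}

-- Generalised Stirling numbers S(n,k,α,β,γ): the unique coefficients with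
--   (t|α)_n = Σ_{k=0}^n S(n,k,α,β,γ) (t-γ|β)_k .
-- Since (t|α)_{n+1} = (t|α)_n (t - nα) and
--   (t-γ|β)_k (t - nα) = (t-γ|β)_{k+1} + (kβ + γ - nα) (t-γ|β)_k ,
-- comparing coefficients in the (monic, hence basis) family (t-γ|β)_k gives
--   S(0,0) = 1, S(0,k+1) = 0, S(n+1,0) = (γ - nα) S(n,0),
--   S(n+1,k+1) = S(n,k) + ((k+1)β + γ - nα) S(n,k+1),
-- which is what we take as the definition (it also gives S(i,k)=0 for k>i).
S : ℕ → ℕ → ℤ → ℤ → ℤ → ℤ
S zero    zero    α β γ = + 1
S zero    (suc k) α β γ = + 0
S (suc n) zero    α β γ = (γ - (+ n) * α) * S n zero α β γ
S (suc n) (suc k) α β γ =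
  S n k α β γ + ((+ suc k) * β + γ - (+ n) * α) * S n (suc k) α β γ

A : ℕ → ℤ → ℕ → ℤ → ℤ → ℤ → ℤ
A l x n α β γ =
  sumTo n (λ k → (+ binomL l k) * (- (+ 1)) ^ (n ℕ.+ k) * β ^ k * (+ (k !))
                 * S n k α (- β) (- γ) * x ^ k)

{-# OPTIONS --safe #-}
-- Expand S(n,k,α,-β,-γ) by the binomial identity in the shift parameter
--   S(n,k,α,β,γ) = Σᵢ C(n,i) S(i,k,α,β,0) (γ|α)_{n-i}
-- and use (-γ|α)_m = (-1)^m (γ|-α)_m; the signs then combine to (-1)^(k+i).
-- The identity holds because binomial convolution with (γ|α)_m carries the
-- recurrence of S(·,k,α,β,0) to that of S(·,k,α,β,γ): Pascal's rule splits the
-- convolution at n+1 into two at n, and the factor γ - (n-i)α from (γ|α) and the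
-- factor kβ - iα from the recurrence add up to kβ + γ - nα.
module Submission where

open import Data.Integer using (ℤ; +_; _+_; _-_; _*_; -_; _^_; 0ℤ; 1ℤ; -1ℤ)
import Data.Integer.Properties as ℤₚ
open import Data.Integer.Tactic.RingSolver using (solve-∀)
open import Data.Nat using (ℕ; zero; suc; _∸_; _!; _≤_; z≤n)
import Data.Nat as ℕ
import Data.Nat.Properties as ℕₚ
open import Data.Nat.Combinatorics using (_C_; nCk+nC[k+1]≡[n+1]C[k+1]; k>n⇒nCk≡0)
open import Algebra.Properties.CommutativeSemigroup ℤₚ.+-commutativeSemigroup
  using () renaming (interchange to +-interchange)
open import Data.Product using (_×_)
open import Function using (_∘_)
open import Relation.Nullary using (¬_)
open import Relation.Binary.PropositionalEquality
  using (_≡_; refl; sym; trans; cong; cong₂; module ≡-Reasoning)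

open import Defs

open ≡-Reasoning

sumTo-cong : ∀ n {f g : ℕ → ℤ} → (∀ {i} → i ≤ n → f i ≡ g i) → sumTo n f ≡ sumTo n g
sumTo-cong zero    f≗g = f≗g z≤n
sumTo-cong (suc n) f≗g =
  cong₂ _+_ (sumTo-cong n (f≗g ∘ ℕₚ.m≤n⇒m≤1+n)) (f≗g ℕₚ.≤-refl)

sumTo-zero : ∀ n {f : ℕ → ℤ} → (∀ i → f i ≡ 0ℤ) → sumTo n f ≡ 0ℤ
sumTo-zero zero    f≗0 = f≗0 0
sumTo-zero (suc n) f≗0 = cong₂ _+_ (sumTo-zero n f≗0) (f≗0 (suc n))

sumTo-distrib-+ : ∀ n (f g : ℕ → ℤ) → sumTo n (λ i → f i + g i) ≡ sumTo n f + sumTo n g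
sumTo-distrib-+ zero    f g = refl
sumTo-distrib-+ (suc n) f g = begin
  sumTo n (λ i → f i + g i) + (f (suc n) + g (suc n))
    ≡⟨ cong (_+ (f (suc n) + g (suc n))) (sumTo-distrib-+ n f g) ⟩
  (sumTo n f + sumTo n g) + (f (suc n) + g (suc n))
    ≡⟨ +-interchange (sumTo n f) (sumTo n g) (f (suc n)) (g (suc n)) ⟩
  (sumTo n f + f (suc n)) + (sumTo n g + g (suc n))  ∎

sumTo-*ˡ : ∀ n c (f : ℕ → ℤ) → sumTo n (λ i → c * f i) ≡ c * sumTo n f
sumTo-*ˡ zero    c f = refl
sumTo-*ˡ (suc n) c f = trans (cong (_+ c * f (suc n)) (sumTo-*ˡ n c f))
                             (sym (ℤₚ.*-distribˡ-+ c (sumTo n f) (f (suc n))))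

sumTo-sucˡ : ∀ n (f : ℕ → ℤ) → sumTo (suc n) f ≡ f 0 + sumTo n (f ∘ suc)
sumTo-sucˡ zero    f = refl
sumTo-sucˡ (suc n) f = trans (cong (_+ f (suc (suc n))) (sumTo-sucˡ n f))
                             (ℤₚ.+-assoc (f 0) _ _)

binomialConvolution : ℕ → (ℕ → ℤ) → (ℕ → ℤ) → ℤ
binomialConvolution n u v = sumTo n (λ i → + (n C i) * u i * v (n ∸ i))

binomialConvolution-suc : ∀ n (u v : ℕ → ℤ) →
  binomialConvolution (suc n) u v
    ≡ binomialConvolution n u (v ∘ suc) + binomialConvolution n (u ∘ suc) v
binomialConvolution-suc n u v = begin
  binomialConvolution (suc n) u v
    ≡⟨ sumTo-sucˡ n _ ⟩
  first + sumTo n (λ i → + (suc n C suc i) * u (suc i) * v (n ∸ i))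
    ≡⟨ cong (λ s → first + s) (trans (sumTo-cong n pascal) (sumTo-distrib-+ n _ _)) ⟩
  first + (sumTo n upper + binomialConvolution n (u ∘ suc) v)
    ≡⟨ sym (ℤₚ.+-assoc first (sumTo n upper) _) ⟩
  (first + sumTo n upper) + binomialConvolution n (u ∘ suc) v
    ≡⟨ cong (_+ binomialConvolution n (u ∘ suc) v) (sym lower) ⟩
  binomialConvolution n u (v ∘ suc) + binomialConvolution n (u ∘ suc) v  ∎
  where
  first : ℤ
  first = + (suc n C 0) * u 0 * v (suc n)

  upper : ℕ → ℤ
  upper i = + (n C suc i) * u (suc i) * v (n ∸ i)

  pascal : ∀ {i} → i ≤ n →
    + (suc n C suc i) * u (suc i) * v (n ∸ i) ≡ upper i + + (n C i) * u (suc i) * v (n ∸ i)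
  pascal {i} _ = begin
    + (suc n C suc i) * u (suc i) * v (n ∸ i)
      ≡⟨ cong (λ c → + c * u (suc i) * v (n ∸ i)) (sym (nCk+nC[k+1]≡[n+1]C[k+1] n i)) ⟩
    + (n C i ℕ.+ n C suc i) * u (suc i) * v (n ∸ i)
      ≡⟨ cong (λ c → c * u (suc i) * v (n ∸ i)) (ℤₚ.pos-+ (n C i) (n C suc i)) ⟩
    (+ (n C i) + + (n C suc i)) * u (suc i) * v (n ∸ i)
      ≡⟨ *-distribʳ-+-twice (+ (n C i)) (+ (n C suc i)) (u (suc i)) (v (n ∸ i)) ⟩
    upper i + + (n C i) * u (suc i) * v (n ∸ i)  ∎
    where
    *-distribʳ-+-twice : ∀ a b x y → (a + b) * x * y ≡ b * x * y + a * x * y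
    *-distribʳ-+-twice = solve-∀

  shifted : ℕ → ℤ
  shifted i = + (n C i) * u i * v (suc n ∸ i)

  lower : binomialConvolution n u (v ∘ suc) ≡ first + sumTo n upper
  lower = begin
    binomialConvolution n u (v ∘ suc)
      ≡⟨ sumTo-cong n (λ {i} i≤n → cong (λ m → + (n C i) * u i * v m) (sym (ℕₚ.+-∸-assoc 1 i≤n))) ⟩
    sumTo n shifted
      ≡⟨ sym (ℤₚ.+-identityʳ _) ⟩
    sumTo n shifted + 0ℤ
      ≡⟨ cong (λ c → sumTo n shifted + + c * u (suc n) * v (n ∸ n)) (sym (k>n⇒nCk≡0 (ℕₚ.n<1+n n))) ⟩
    sumTo (suc n) shifted
      ≡⟨ sumTo-sucˡ n shifted ⟩
    first + sumTo n upper  ∎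

S⁻ : ℕ → ℕ → ℤ → ℤ → ℤ → ℤ
S⁻ n zero    α β γ = 0ℤ
S⁻ n (suc k) α β γ = S n k α β γ

S-suc : ∀ n k α β γ →
  S (suc n) k α β γ ≡ S⁻ n k α β γ + ((+ k) * β + γ - (+ n) * α) * S n k α β γ
S-suc n zero    α β γ = lemma γ (+ n) α β (S n zero α β γ)
  where
  lemma : ∀ γ m α β s → (γ - m * α) * s ≡ 0ℤ + (0ℤ * β + γ - m * α) * s
  lemma = solve-∀
S-suc n (suc k) α β γ = refl

binomialConvolution-fall-recurrence : ∀ α γ κ (u w : ℕ → ℤ) →
  (∀ i → u (suc i) ≡ w i + (κ - + i * α) * u i) → ∀ n →
  binomialConvolution (suc n) u (fall γ α)
    ≡ binomialConvolution n w (fall γ α) + (κ + γ - + n * α) * binomialConvolution n u (fall γ α)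
binomialConvolution-fall-recurrence α γ κ u w u-rec n = begin
  binomialConvolution (suc n) u (fall γ α)
    ≡⟨ binomialConvolution-suc n u (fall γ α) ⟩
  binomialConvolution n u (fall γ α ∘ suc) + binomialConvolution n (u ∘ suc) (fall γ α)
    ≡⟨ sym (sumTo-distrib-+ n _ _) ⟩
  sumTo n (λ i → + (n C i) * u i * fall γ α (suc (n ∸ i)) + + (n C i) * u (suc i) * fall γ α (n ∸ i))
    ≡⟨ sumTo-cong n termwise ⟩
  sumTo n (λ i → + (n C i) * w i * fall γ α (n ∸ i) + K * (+ (n C i) * u i * fall γ α (n ∸ i)))
    ≡⟨ sumTo-distrib-+ n _ _ ⟩
  binomialConvolution n w (fall γ α) + sumTo n (λ i → K * (+ (n C i) * u i * fall γ α (n ∸ i)))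
    ≡⟨ cong (λ s → binomialConvolution n w (fall γ α) + s) (sumTo-*ˡ n K _) ⟩
  binomialConvolution n w (fall γ α) + K * binomialConvolution n u (fall γ α)  ∎
  where
  K : ℤ
  K = κ + γ - + n * α

  termwise : ∀ {i} → i ≤ n →
    + (n C i) * u i * fall γ α (suc (n ∸ i)) + + (n C i) * u (suc i) * fall γ α (n ∸ i)
      ≡ + (n C i) * w i * fall γ α (n ∸ i) + K * (+ (n C i) * u i * fall γ α (n ∸ i))
  termwise {i} i≤n = begin
    c * u i * (f * (γ - + (n ∸ i) * α)) + c * u (suc i) * f
      ≡⟨ cong (λ s → c * u i * (f * (γ - + (n ∸ i) * α)) + c * s * f) (u-rec i) ⟩
    c * u i * (f * (γ - + (n ∸ i) * α)) + c * (w i + (κ - + i * α) * u i) * f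
      ≡⟨ lemma c (u i) (w i) f κ γ α (+ (n ∸ i)) (+ i) ⟩
    c * w i * f + (κ + γ - (+ (n ∸ i) + + i) * α) * (c * u i * f)
      ≡⟨ cong (λ m → c * w i * f + (κ + γ - m * α) * (c * u i * f)) n∸i+i≡n ⟩
    c * w i * f + K * (c * u i * f)  ∎
    where
    c = + (n C i)
    f = fall γ α (n ∸ i)

    n∸i+i≡n : + (n ∸ i) + + i ≡ + n
    n∸i+i≡n = trans (sym (ℤₚ.pos-+ (n ∸ i) i)) (cong +_ (ℕₚ.m∸n+n≡m i≤n))

    lemma : ∀ c u w f κ γ α m i →
      c * u * (f * (γ - m * α)) + c * (w + (κ - i * α) * u) * f
        ≡ c * w * f + (κ + γ - (m + i) * α) * (c * u * f)
    lemma = solve-∀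

mutual
  S≡binomialConvolution-fall : ∀ α β γ n k →
    S n k α β γ ≡ binomialConvolution n (λ i → S i k α β 0ℤ) (fall γ α)
  S≡binomialConvolution-fall α β γ zero    zero    = refl
  S≡binomialConvolution-fall α β γ zero    (suc k) = refl
  S≡binomialConvolution-fall α β γ (suc n) k       = begin
    S (suc n) k α β γ
      ≡⟨ S-suc n k α β γ ⟩
    S⁻ n k α β γ + K * S n k α β γ
      ≡⟨ cong₂ (λ s t → s + K * t) (S⁻≡binomialConvolution-fall α β γ n k)
                                    (S≡binomialConvolution-fall α β γ n k) ⟩
    binomialConvolution n (λ i → S⁻ i k α β 0ℤ) (fall γ α)
      + K * binomialConvolution n (λ i → S i k α β 0ℤ) (fall γ α)
      ≡⟨ sym (binomialConvolution-fall-recurrence α γ (+ k * β) _ _ S₀-suc n) ⟩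
    binomialConvolution (suc n) (λ i → S i k α β 0ℤ) (fall γ α)  ∎
    where
    K : ℤ
    K = + k * β + γ - + n * α

    S₀-suc : ∀ i → S (suc i) k α β 0ℤ ≡ S⁻ i k α β 0ℤ + (+ k * β - + i * α) * S i k α β 0ℤ
    S₀-suc i = trans (S-suc i k α β 0ℤ)
      (cong (λ κ → S⁻ i k α β 0ℤ + (κ - + i * α) * S i k α β 0ℤ) (ℤₚ.+-identityʳ (+ k * β)))

  S⁻≡binomialConvolution-fall : ∀ α β γ n k →
    S⁻ n k α β γ ≡ binomialConvolution n (λ i → S⁻ i k α β 0ℤ) (fall γ α)
  S⁻≡binomialConvolution-fall α β γ n zero    =
    sym (sumTo-zero n (λ i → cong (_* fall γ α (n ∸ i)) (ℤₚ.*-zeroʳ (+ (n C i)))))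
  S⁻≡binomialConvolution-fall α β γ n (suc k) = S≡binomialConvolution-fall α β γ n k

fall-neg : ∀ t α m → fall (- t) α m ≡ -1ℤ ^ m * fall t (- α) m
fall-neg t α zero    = refl
fall-neg t α (suc m) = begin
  fall (- t) α m * (- t - + m * α)
    ≡⟨ cong (_* (- t - + m * α)) (fall-neg t α m) ⟩
  -1ℤ ^ m * fall t (- α) m * (- t - + m * α)
    ≡⟨ lemma (-1ℤ ^ m) (fall t (- α) m) t (+ m) α ⟩
  -1ℤ * -1ℤ ^ m * (fall t (- α) m * (t - + m * - α))  ∎
  where
  lemma : ∀ s F t m α → s * F * (- t - m * α) ≡ -1ℤ * s * (F * (t - m * - α))
  lemma = solve-∀

-1^m*-1^m≡1 : ∀ m → -1ℤ ^ m * -1ℤ ^ m ≡ 1ℤ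
-1^m*-1^m≡1 m = begin
  -1ℤ ^ m * -1ℤ ^ m    ≡⟨ ℤₚ.^-distribˡ-+-* -1ℤ m m ⟨
  -1ℤ ^ (m ℕ.+ m)      ≡⟨ cong (-1ℤ ^_) (cong (m ℕ.+_) (ℕₚ.+-identityʳ m)) ⟨
  -1ℤ ^ (2 ℕ.* m)      ≡⟨ ℤₚ.^-*-assoc -1ℤ 2 m ⟨
  1ℤ ^ m               ≡⟨ ℤₚ.^-zeroˡ m ⟩
  1ℤ                   ∎

-1^[n+k]*-1^[n∸i]≡-1^[k+i] : ∀ {n i} k → i ≤ n → -1ℤ ^ (n ℕ.+ k) * -1ℤ ^ (n ∸ i) ≡ -1ℤ ^ (k ℕ.+ i)
-1^[n+k]*-1^[n∸i]≡-1^[k+i] {n} {i} k i≤n = begin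
  -1ℤ ^ (n ℕ.+ k) * s
    ≡⟨ cong (λ e → -1ℤ ^ e * s) n+k≡[n∸i]+[k+i] ⟩
  -1ℤ ^ ((n ∸ i) ℕ.+ (k ℕ.+ i)) * s
    ≡⟨ cong (_* s) (ℤₚ.^-distribˡ-+-* -1ℤ (n ∸ i) (k ℕ.+ i)) ⟩
  s * -1ℤ ^ (k ℕ.+ i) * s
    ≡⟨ lemma s (-1ℤ ^ (k ℕ.+ i)) ⟩
  s * s * -1ℤ ^ (k ℕ.+ i)
    ≡⟨ cong (_* -1ℤ ^ (k ℕ.+ i)) (-1^m*-1^m≡1 (n ∸ i)) ⟩
  1ℤ * -1ℤ ^ (k ℕ.+ i)
    ≡⟨ ℤₚ.*-identityˡ _ ⟩
  -1ℤ ^ (k ℕ.+ i)  ∎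
  where
  s = -1ℤ ^ (n ∸ i)

  n+k≡[n∸i]+[k+i] : n ℕ.+ k ≡ (n ∸ i) ℕ.+ (k ℕ.+ i)
  n+k≡[n∸i]+[k+i] = begin
    n ℕ.+ k                    ≡⟨ cong (ℕ._+ k) (ℕₚ.m∸n+n≡m i≤n) ⟨
    (n ∸ i) ℕ.+ i ℕ.+ k        ≡⟨ ℕₚ.+-assoc (n ∸ i) i k ⟩
    (n ∸ i) ℕ.+ (i ℕ.+ k)      ≡⟨ cong ((n ∸ i) ℕ.+_) (ℕₚ.+-comm i k) ⟩
    (n ∸ i) ℕ.+ (k ℕ.+ i)      ∎

  lemma : ∀ s t → s * t * s ≡ s * s * t
  lemma = solve-∀

A-expansion : ∀ l (x α β γ : ℤ) n →
  A l x n α β γ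
    ≡ sumTo n (λ k → + binomL l k
        * sumTo n (λ i → + (n C i) * x ^ k * -1ℤ ^ (k ℕ.+ i)
            * β ^ k * + (k !) * S i k α (- β) 0ℤ * fall γ (- α) (n ∸ i)))
A-expansion l x α β γ n = sumTo-cong n λ {k} _ → summand k
  where
  summand : ∀ k →
    + binomL l k * -1ℤ ^ (n ℕ.+ k) * β ^ k * + (k !) * S n k α (- β) (- γ) * x ^ k
      ≡ + binomL l k * sumTo n (λ i → + (n C i) * x ^ k * -1ℤ ^ (k ℕ.+ i)
            * β ^ k * + (k !) * S i k α (- β) 0ℤ * fall γ (- α) (n ∸ i))
  summand k = begin
    L * σ * B * F * S n k α (- β) (- γ) * X
      ≡⟨ regroup L σ B F (S n k α (- β) (- γ)) X ⟩
    L * (σ * B * F * X * S n k α (- β) (- γ))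
      ≡⟨ cong (λ s → L * (σ * B * F * X * s)) (S≡binomialConvolution-fall α (- β) (- γ) n k) ⟩
    L * (σ * B * F * X * binomialConvolution n u (fall (- γ) α))
      ≡⟨ cong (L *_) (sym (sumTo-*ˡ n (σ * B * F * X) _)) ⟩
    L * sumTo n (λ i → σ * B * F * X * (+ (n C i) * u i * fall (- γ) α (n ∸ i)))
      ≡⟨ cong (L *_) (sumTo-cong n termwise) ⟩
    L * sumTo n (λ i → + (n C i) * X * -1ℤ ^ (k ℕ.+ i) * B * F * u i * fall γ (- α) (n ∸ i))  ∎
    where
    L = + binomL l k
    σ = -1ℤ ^ (n ℕ.+ k)
    B = β ^ k
    F = + (k !)
    X = x ^ k

    u : ℕ → ℤ
    u i = S i k α (- β) 0ℤ

    regroup : ∀ L σ B F S X → L * σ * B * F * S * X ≡ L * (σ * B * F * X * S)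
    regroup = solve-∀

    termwise : ∀ {i} → i ≤ n →
      σ * B * F * X * (+ (n C i) * u i * fall (- γ) α (n ∸ i))
        ≡ + (n C i) * X * -1ℤ ^ (k ℕ.+ i) * B * F * u i * fall γ (- α) (n ∸ i)
    termwise {i} i≤n = begin
      σ * B * F * X * (c * u i * fall (- γ) α (n ∸ i))
        ≡⟨ cong (λ f → σ * B * F * X * (c * u i * f)) (fall-neg γ α (n ∸ i)) ⟩
      σ * B * F * X * (c * u i * (-1ℤ ^ (n ∸ i) * f))
        ≡⟨ regroup′ σ B F X c (u i) (-1ℤ ^ (n ∸ i)) f ⟩
      c * X * (σ * -1ℤ ^ (n ∸ i)) * B * F * u i * f
        ≡⟨ cong (λ s → c * X * s * B * F * u i * f) (-1^[n+k]*-1^[n∸i]≡-1^[k+i] k i≤n) ⟩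
      c * X * -1ℤ ^ (k ℕ.+ i) * B * F * u i * f  ∎
      where
      c = + (n C i)
      f = fall γ (- α) (n ∸ i)

      regroup′ : ∀ σ B F X c u τ f →
        σ * B * F * X * (c * u * (τ * f)) ≡ c * X * (σ * τ) * B * F * u * f
      regroup′ = solve-∀

mainTheorem4 : (α β γ x l : ℕ) →
    ¬ (α ≡ 0 × β ≡ 0 × γ ≡ 0 × x ≡ 0) →
    (n : ℕ) →
    A l (+ x) n (+ α) (+ β) (+ γ)
      ≡ sumTo n (λ k → (+ binomL l k)
          * sumTo n (λ i → (+ (n C i)) * (+ x) ^ k * (- (+ 1)) ^ (k ℕ.+ i)
              * (+ β) ^ k * (+ (k !)) * S i k (+ α) (- (+ β)) (+ 0)
              * fall (+ γ) (- (+ α)) (n ∸ i)))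
mainTheorem4 α β γ x l _ n = A-expansion l (+ x) (+ α) (+ β) (+ γ) n
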